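{- Let $d,n_1,n_2,n_1',n_2',m,m'$ be positive integers. Assume that: \begin{enumerate} \item there are a set of points $P^{d-1}\subseteq\mathbb{R}^{d-1}$ with $|P^{d-1}|=n_1$ and a set $B^{d-1}$ of $n_2$ $(d-1)$-dimensional boxes with exactly $m$ incidences between them, and their incidence graph is $K_{2,2}$-free; \item there are a set of points $P^d\subseteq\mathbb{R}^d$ with $|P^d|=n_1'$ and a set $B^d$ of $n_2'$ $d$-dimensional boxes with exactly $m'$ incidences between them, and their incidence graph is $K_{2,2}$-free. \end{enumerate} Then there exist a set of points $P\subseteq\mathbb{R}^d$ with $|P|=n_1n_1'$ and a set $B$ of $n_1n_2'+n_1'n_2$ $d$-dimensional boxes such that there are exactly $n_1m'+mn_1'$ incidences between $P$ and $B$ and their incidence graph is $K_{2,2}$-free.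
   Context: A $j$-dimensional box is a product of $j$ bounded intervals in $\mathbb{R}^j$ (axis-parallel sides). An incidence between a point set and a set of boxes is a pair (point, box) with the point lying in the box; the incidence graph is the bipartite graph of these pairs. $K_{2,2}$-free means no two points both lie in two common boxes.
   Formalization: The points and box endpoints of all three configurations are taken in the rationals, lying in ℚ^(d-1) and ℚ^d rather than $\mathbb{R}^{d-1}$ and $\mathbb{R}^d$. -}

module Defs where

open import Data.Bool using (Bool; true; false)
open import Data.Nat using (ℕ; _+_)
open import Data.Fin using (Fin)
open import Data.List using (List; map; allFin)
open import Data.Nat.ListAction using (sum)
open import Data.Product using (_×_; _,_)
open import Data.Rational using (ℚ; _≤_; _<_)
open import Data.Rational.Properties using (_≤?_; _<?_)
open import Relation.Nullary using (Dec; yes; no; ¬_)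
open import Relation.Nullary.Decidable using (_×-dec_)
open import Relation.Binary.PropositionalEquality using (_≡_; _≢_)

Point : ℕ → Set
Point j = Fin j → ℚ

record Interval : Set where
  constructor interval
  field
    lo       : ℚ
    hi       : ℚ
    loClosed : Bool
    hiClosed : Bool
open Interval public

Box : ℕ → Set
Box j = Fin j → Interval

LoOk : Bool → ℚ → ℚ → Set
LoOk true  a x = a ≤ x
LoOk false a x = a < x

loOk? : ∀ b a x → Dec (LoOk b a x)
loOk? true  a x = a ≤? x
loOk? false a x = a <? x

_∈I_ : ℚ → Interval → Set
x ∈I I = LoOk (loClosed I) (lo I) x × LoOk (hiClosed I) x (hi I)

_∈I?_ : ∀ x I → Dec (x ∈I I)
x ∈I? I = loOk? (loClosed I) (lo I) x ×-dec loOk? (hiClosed I) x (hi I)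

_∈B_ : ∀ {j} → Point j → Box j → Set
p ∈B b = ∀ i → p i ∈I b i

allDec : ∀ {k} {P : Fin k → Set} → (∀ i → Dec (P i)) → Dec (∀ i → P i)
allDec {ℕ.zero} d = yes (λ ())
allDec {ℕ.suc k} {P} d with d Fin.zero | allDec {k} {λ i → P (Fin.suc i)} (λ i → d (Fin.suc i))
... | yes p | yes q = yes λ { Fin.zero → p ; (Fin.suc i) → q i }
... | no ¬p | _     = no λ f → ¬p (f Fin.zero)
... | yes _ | no ¬q = no λ f → ¬q (λ i → f (Fin.suc i))

_∈B?_ : ∀ {j} (p : Point j) (b : Box j) → Dec (p ∈B b)
p ∈B? b = allDec (λ i → p i ∈I? b i)

ind : ∀ {j} → Point j → Box j → ℕ
ind p b with p ∈B? b
... | yes _ = 1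
... | no _  = 0

incidences : ∀ {j n₁ n₂} → (Fin n₁ → Point j) → (Fin n₂ → Box j) → ℕ
incidences {n₁ = n₁} {n₂} P B =
  sum (map (λ a → sum (map (λ c → ind (P a) (B c)) (allFin n₂))) (allFin n₁))

DistinctPoints : ∀ {j n} → (Fin n → Point j) → Set
DistinctPoints {n = n} P = ∀ (a a' : Fin n) → a ≢ a' → ¬ (∀ i → P a i ≡ P a' i)

-- A set of n boxes: pairwise distinct as subsets of ℚ^j.
DistinctBoxes : ∀ {j n} → (Fin n → Box j) → Set
DistinctBoxes {j} {n} B =
  ∀ (c c' : Fin n) → c ≢ c' →
    ¬ (∀ (p : Point j) → (p ∈B B c → p ∈B B c') × (p ∈B B c' → p ∈B B c))

K22Free : ∀ {j n₁ n₂} → (Fin n₁ → Point j) → (Fin n₂ → Box j) → Set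
K22Free {n₁ = n₁} {n₂} P B =
  ∀ (a a' : Fin n₁) (c c' : Fin n₂) → a ≢ a' → c ≢ c' →
    ¬ ((P a ∈B B c × P a ∈B B c') × (P a' ∈B B c × P a' ∈B B c'))

record Config (j n₁ n₂ m : ℕ) : Set where
  field
    pts      : Fin n₁ → Point j
    boxes    : Fin n₂ → Box j
    ptsDist  : DistinctPoints pts
    boxDist  : DistinctBoxes boxes
    incCount : incidences pts boxes ≡ m
    k22free  : K22Free pts boxes

{-# OPTIONS --safe #-}
module Submission where

-- A point of the new configuration is a pair (a , a′) of a point a of the (d-1)-dimensional
-- configuration P and a point a′ of the d-dimensional configuration Q; a box is either a pair
-- (a , b′) of a point of P and a box of Q, or a pair (a′ , b) of a point of Q and a box of P.
-- Coordinates encode pairs lexicographically: K u + s with |s| ≤ h stands for (u , s), where K is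
-- so large that the windows of radius h around the K u, for the finitely many coordinates u in
-- play, are disjoint. The point (a , a′) has coordinate 0 equal to (a′₀ , a′) and coordinate k+1
-- equal to (a_k , a′_{k+1}). The box (a , b′) is b′₀ widened to whole windows in coordinate 0 and
-- {a_k} × b′_{k+1} in coordinate k+1, so it contains (α , α′) iff α = a and α′ ∈ b′; the box
-- (a′ , b) is the single value (a′₀ , a′) in coordinate 0 and b_k widened in coordinate k+1, so it
-- contains (α , α′) iff α′ = a′ and α ∈ b. The incidence graph is therefore the Cartesian
-- product of the two given ones: it is K_{2,2}-free, and (a , a′) has degree deg a′ + deg a.
-- Distinct boxes are distinct point sets because nonempty boxes are determined by their points;
-- boxes can be made nonempty beforehand by moving an empty box (there is at most one) to a
-- degenerate box far away.

open import Defs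

open import Data.Bool using (Bool; true; false; T)
open import Data.Fin using (Fin; zero; suc; splitAt; remQuot)
open import Data.Nat using (ℕ; zero; suc)
open import Data.Product using (∃; Σ; _×_; _,_; proj₁; proj₂)
open import Data.Rational using (ℚ)
open import Data.Sum using (_⊎_; inj₁; inj₂)
open import Function using (_∘_; _∘₂_; id; const)
open import Relation.Binary.PropositionalEquality
  using (_≡_; _≢_; refl; sym; trans; cong; cong₂; subst; subst₂; _≗_; module ≡-Reasoning)
open import Relation.Nullary using (¬_; Dec; yes; no; contradiction)

module Boxes where

  open import Algebra.Properties.Group using (\\-leftDividesʳ)
  open import Data.Bool as Bool using (b≤b; f≤t)
  import Data.Bool.Properties as Bool
  open import Data.Fin.Properties using (_≟_)
  open import Data.Rational using (_≤_; _<_; _+_; -_)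
  open import Data.Rational.Properties
    using (≤-refl; ≤-trans; ≤-antisym; <⇒≤; <-irrefl; <-≤-trans; ≤-<-trans; <-cmp; <-dense; ≮⇒≥;
           +-monoʳ-≤; +-monoʳ-<; +-0-group)
  open import Data.Vec.Functional using (updateAt)
  open import Data.Vec.Functional.Properties using (updateAt-updates; updateAt-minimal)
  open import Relation.Binary.Definitions using (tri<; tri≈; tri>)

  <⇒≱ : ∀ {p q} → p < q → ¬ (q ≤ p)
  <⇒≱ p<q q≤p = <-irrefl refl (<-≤-trans p<q q≤p)

  ≤⇒<⊎≡ : ∀ {p q} → p ≤ q → p < q ⊎ p ≡ q
  ≤⇒<⊎≡ {p} {q} p≤q with <-cmp p q
  ... | tri< p<q _ _ = inj₁ p<q
  ... | tri≈ _ p≡q _ = inj₂ p≡q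
  ... | tri> _ _ q<p = contradiction p≤q (<⇒≱ q<p)

  -r+[r+p]≡p : ∀ r p → - r + (r + p) ≡ p
  -r+[r+p]≡p = \\-leftDividesʳ +-0-group

  +-cancelˡ-≤ : ∀ r {p q} → r + p ≤ r + q → p ≤ q
  +-cancelˡ-≤ r {p} {q} = subst₂ _≤_ (-r+[r+p]≡p r p) (-r+[r+p]≡p r q) ∘ +-monoʳ-≤ (- r)

  +-cancelˡ-< : ∀ r {p q} → r + p < r + q → p < q
  +-cancelˡ-< r {p} {q} = subst₂ _<_ (-r+[r+p]≡p r p) (-r+[r+p]≡p r q) ∘ +-monoʳ-< (- r)

  LoOk⇒≤ : ∀ f {p q} → LoOk f p q → p ≤ q
  LoOk⇒≤ true  p≤q = p≤q
  LoOk⇒≤ false p<q = <⇒≤ p<q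

  <⇒LoOk : ∀ f {p q} → p < q → LoOk f p q
  <⇒LoOk true  = <⇒≤
  <⇒LoOk false = id

  ≤-LoOk-trans : ∀ f {p q r} → p ≤ q → LoOk f q r → LoOk f p r
  ≤-LoOk-trans true  = ≤-trans
  ≤-LoOk-trans false = ≤-<-trans

  LoOk-≤-trans : ∀ f {p q r} → LoOk f p q → q ≤ r → LoOk f p r
  LoOk-≤-trans true  = ≤-trans
  LoOk-≤-trans false = <-≤-trans

  T⇒LoOk-refl : ∀ f {p} → T f → LoOk f p p
  T⇒LoOk-refl true _ = ≤-refl

  LoOk-refl⇒T : ∀ f {p} → LoOk f p p → T f
  LoOk-refl⇒T true  _   = _
  LoOk-refl⇒T false p<p = <-irrefl refl p<p

  LoOk-+ˡ⁺ : ∀ f r {p q} → LoOk f p q → LoOk f (r + p) (r + q)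
  LoOk-+ˡ⁺ true  r = +-monoʳ-≤ r
  LoOk-+ˡ⁺ false r = +-monoʳ-< r

  LoOk-+ˡ⁻ : ∀ f r {p q} → LoOk f (r + p) (r + q) → LoOk f p q
  LoOk-+ˡ⁻ true  = +-cancelˡ-≤
  LoOk-+ˡ⁻ false = +-cancelˡ-<

  [_] : ℚ → Interval
  [ x ] = interval x x true true

  ∈-[]⁻ : ∀ {x y} → y ∈I [ x ] → y ≡ x
  ∈-[]⁻ (x≤y , y≤x) = ≤-antisym y≤x x≤y

  ∈-interval-< : ∀ {l r} f g → l < r → ∃ (_∈I interval l r f g)
  ∈-interval-< f g l<r with <-dense l<r
  ... | x , l<x , x<r = x , <⇒LoOk f l<x , <⇒LoOk g x<r

  ∈I⇒<⊎closed : ∀ {l r f g x} → x ∈I interval l r f g →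
                l < r ⊎ (l ≡ r × f ≡ true × g ≡ true)
  ∈I⇒<⊎closed {f = false} {g} (l<x , xr) = inj₁ (<-≤-trans l<x (LoOk⇒≤ g xr))
  ∈I⇒<⊎closed {f = true} {false} (l≤x , x<r) = inj₁ (≤-<-trans l≤x x<r)
  ∈I⇒<⊎closed {f = true} {true} (l≤x , x≤r) with ≤⇒<⊎≡ (≤-trans l≤x x≤r)
  ... | inj₁ l<r = inj₁ l<r
  ... | inj₂ l≡r = inj₂ (l≡r , refl , refl)

  nonempty-degenerate? : ∀ {l} f g → Dec (∃ (_∈I interval l l f g))
  nonempty-degenerate? true  true  = yes (_ , ≤-refl , ≤-refl)
  nonempty-degenerate? false g     = no λ (_ , l<x , x≤l) → <⇒≱ l<x (LoOk⇒≤ g x≤l)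
  nonempty-degenerate? true  false = no λ (_ , l≤x , x<l) → <⇒≱ x<l l≤x

  nonemptyI? : ∀ I → Dec (∃ (_∈I I))
  nonemptyI? (interval l r f g) with <-cmp l r
  ... | tri< l<r _ _ = yes (∈-interval-< f g l<r)
  ... | tri≈ _ refl _ = nonempty-degenerate? f g
  ... | tri> _ _ r<l = no λ (_ , l≤x , x≤r) →
    <⇒≱ r<l (≤-trans (LoOk⇒≤ f l≤x) (LoOk⇒≤ g x≤r))

  _⊆I_ : Interval → Interval → Set
  I ⊆I J = ∀ {x} → x ∈I I → x ∈I J

  ⊆⇒lo-≥ : ∀ {I J x} → x ∈I I → I ⊆I J → lo J ≤ lo I
  ⊆⇒lo-≥ {interval l r f g} {interval l′ r′ f′ g′} x∈I@(_ , x≤r) I⊆J = ≮⇒≥ λ l<l′ →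
    let (y , l<y , y<l′) = <-dense l<l′
        y≤x = <⇒≤ (<-≤-trans y<l′ (LoOk⇒≤ f′ (proj₁ (I⊆J x∈I))))
        y∈J = I⊆J (<⇒LoOk f l<y , ≤-LoOk-trans g y≤x x≤r)
    in <⇒≱ y<l′ (LoOk⇒≤ f′ (proj₁ y∈J))

  ⊆⇒hi-≤ : ∀ {I J x} → x ∈I I → I ⊆I J → hi I ≤ hi J
  ⊆⇒hi-≤ {interval l r f g} {interval l′ r′ f′ g′} x∈I@(l≤x , _) I⊆J = ≮⇒≥ λ r′<r →
    let (y , r′<y , y<r) = <-dense r′<r
        x≤y = <⇒≤ (≤-<-trans (LoOk⇒≤ g′ (proj₂ (I⊆J x∈I))) r′<y)
        y∈J = I⊆J (LoOk-≤-trans f l≤x x≤y , <⇒LoOk g y<r)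
    in <⇒≱ r′<y (LoOk⇒≤ g′ (proj₂ y∈J))

  ⊆⇒loClosed-≤ : ∀ {l r f g r′ f′ g′ x} → x ∈I interval l r f g →
                 interval l r f g ⊆I interval l r′ f′ g′ → f Bool.≤ f′
  ⊆⇒loClosed-≤ {f = false} {f′ = false} _ _ = b≤b
  ⊆⇒loClosed-≤ {f = false} {f′ = true}  _ _ = f≤t
  ⊆⇒loClosed-≤ {f = true}  {f′ = true}  _ _ = b≤b
  ⊆⇒loClosed-≤ {f = true} {g} {f′ = false} (l≤x , x≤r) I⊆J =
    contradiction (proj₁ (I⊆J (≤-refl , ≤-LoOk-trans g l≤x x≤r))) (<-irrefl refl)

  ⊆⇒hiClosed-≤ : ∀ {l r f g l′ f′ g′ x} → x ∈I interval l r f g →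
                 interval l r f g ⊆I interval l′ r f′ g′ → g Bool.≤ g′
  ⊆⇒hiClosed-≤ {g = false} {g′ = false} _ _ = b≤b
  ⊆⇒hiClosed-≤ {g = false} {g′ = true}  _ _ = f≤t
  ⊆⇒hiClosed-≤ {g = true}  {g′ = true}  _ _ = b≤b
  ⊆⇒hiClosed-≤ {f = f} {true} {g′ = false} (l≤x , x≤r) I⊆J =
    contradiction (proj₂ (I⊆J (LoOk-≤-trans f l≤x x≤r , ≤-refl))) (<-irrefl refl)

  interval-ext : ∀ {I J x} → x ∈I I → I ⊆I J → J ⊆I I → I ≡ J
  interval-ext {interval l r f g} {interval l′ r′ f′ g′} x∈I I⊆J J⊆I
    with ≤-antisym (⊆⇒lo-≥ (I⊆J x∈I) J⊆I) (⊆⇒lo-≥ x∈I I⊆J)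
       | ≤-antisym (⊆⇒hi-≤ x∈I I⊆J) (⊆⇒hi-≤ (I⊆J x∈I) J⊆I)
  ... | refl | refl = cong₂ (interval l r)
    (Bool.≤-antisym (⊆⇒loClosed-≤ x∈I I⊆J) (⊆⇒loClosed-≤ (I⊆J x∈I) J⊆I))
    (Bool.≤-antisym (⊆⇒hiClosed-≤ x∈I I⊆J) (⊆⇒hiClosed-≤ (I⊆J x∈I) J⊆I))

  Nonempty : ∀ {j} → Box j → Set
  Nonempty B = ∀ i → ∃ (_∈I B i)

  nonempty? : ∀ {j} (B : Box j) → Dec (Nonempty B)
  nonempty? B = allDec (nonemptyI? ∘ B)

  _⊆B_ : ∀ {j} → Box j → Box j → Set
  B ⊆B B′ = ∀ {p} → p ∈B B → p ∈B B′

  ∈B-updateAt : ∀ {j} {B : Box j} {w x} i →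
                w ∈B B → x ∈I B i → updateAt w i (const x) ∈B B
  ∈B-updateAt {B = B} {w} i w∈B x∈Bi k with k ≟ i
  ... | yes refl = subst (_∈I B k) (sym (updateAt-updates k w)) x∈Bi
  ... | no k≢i   = subst (_∈I B k) (sym (updateAt-minimal k i w k≢i)) (w∈B k)

  ⊆B⇒⊆I : ∀ {j} {B B′ : Box j} {w} i → w ∈B B → B ⊆B B′ → B i ⊆I B′ i
  ⊆B⇒⊆I {B′ = B′} {w} i w∈B B⊆B′ x∈Bi =
    subst (_∈I B′ i) (updateAt-updates i w) (B⊆B′ (∈B-updateAt i w∈B x∈Bi) i)

  box-ext : ∀ {j} {B B′ : Box j} → Nonempty B → B ⊆B B′ → B′ ⊆B B → B ≗ B′
  box-ext {B = B} ne B⊆B′ B′⊆B i =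
    interval-ext (w∈B i) (⊆B⇒⊆I i w∈B B⊆B′) (⊆B⇒⊆I i (B⊆B′ w∈B) B′⊆B)
    where
    w∈B : (proj₁ ∘ ne) ∈B B
    w∈B = proj₂ ∘ ne

module Scales where

  open import Data.List using ([]; _∷_; _++_; map; cartesianProductWith)
  open import Data.List.Membership.Propositional using (_∈_)
  open import Data.List.Membership.Propositional.Properties
    using (∈-++⁺ˡ; ∈-++⁺ʳ; ∈-map⁺; ∈-cartesianProductWith⁺)
  open import Data.List.Relation.Unary.All as All using (All; []; _∷_)
  open import Data.Rational
  open import Data.Rational.Properties
  open import Data.Rational.Solver using (module +-*-Solver)
  open import Algebra.Properties.Group +-0-group using (⁻¹-involutive)
  open +-*-Solver

  p<p+1 : ∀ p → p < p + 1ℚ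
  p<p+1 p = subst (_< p + 1ℚ) (+-identityʳ p) (+-monoʳ-< p (positive⁻¹ 1ℚ))

  ∃-upperBound : ∀ xs → ∃ λ T → All (_< T) xs
  ∃-upperBound []       = 0ℚ , []
  ∃-upperBound (x ∷ xs) with ∃-upperBound xs
  ... | T , xs<T =
    x ⊔ T + 1ℚ , ≤-<-trans (p≤p⊔q x T) (p<p+1 _)
               ∷ All.map (λ y<T → <-trans (<-≤-trans y<T (p≤q⊔p x T)) (p<p+1 _)) xs<T

  ∃-stretch : ∀ c ds → ∃ λ K → All (λ d → 0ℚ < d → c < K * d) ds
  ∃-stretch c []       = 0ℚ , []
  ∃-stretch c (d ∷ ds) with ∃-stretch c ds | 0ℚ <? d
  ... | K , stretched | no d≯0 = K , (λ 0<d → contradiction 0<d d≯0) ∷ stretched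
  ... | K , stretched | yes 0<d =
    K ⊔ K′ , (λ _ → <-≤-trans c<K′*d (*-monoʳ-≤-nonNeg d (p≤q⊔p K K′)))
           ∷ All.map (λ c<K*d′ 0<d′ → <-≤-trans (c<K*d′ 0<d′)
                        (*-monoʳ-≤-nonNeg _ {{nonNegative (<⇒≤ 0<d′)}} (p≤p⊔q K K′)))
                     stretched
    where
    instance
      d-nonZero : NonZero d
      d-nonZero = pos⇒nonZero d {{positive 0<d}}
      d-nonNeg : NonNegative d
      d-nonNeg = nonNegative (<⇒≤ 0<d)
    K′ : ℚ
    K′ = (c + 1ℚ) * 1/ d
    c<K′*d : c < K′ * d
    c<K′*d = begin-strict
      c                      <⟨ p<p+1 c ⟩
      c + 1ℚ                 ≡⟨ *-identityʳ (c + 1ℚ) ⟨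
      (c + 1ℚ) * 1ℚ          ≡⟨ cong ((c + 1ℚ) *_) (*-inverseˡ d) ⟨
      (c + 1ℚ) * (1/ d * d)  ≡⟨ *-assoc (c + 1ℚ) (1/ d) d ⟨
      K′ * d                 ∎
      where open ≤-Reasoning

  record LexScale (Base : ℚ → Set) : Set where
    field
      K h   : ℚ
      0<h   : 0ℚ < h
      small : ∀ {v} → Base v → - h ≤ v × v ≤ h
      gap   : ∀ {u w} → Base u → Base w → u < w → K * u + h < K * w - h

  lexScale : ∀ xs → LexScale (_∈ xs)
  lexScale xs with ∃-upperBound (0ℚ ∷ xs ++ map -_ xs)
  ... | h , 0<h ∷ below = record { K = K ; h = h ; 0<h = 0<h ; small = small ; gap = gap }
    where
    small : ∀ {v} → v ∈ xs → - h ≤ v × v ≤ h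
    small {v} v∈ = <⇒≤ (subst (- h <_) (⁻¹-involutive v) (neg-antimono-< -v<h)) , <⇒≤ v<h
      where
      v<h  = All.lookup below (∈-++⁺ˡ v∈)
      -v<h = All.lookup below (∈-++⁺ʳ xs (∈-map⁺ -_ v∈))

    K : ℚ
    K = proj₁ (∃-stretch (h + h) (cartesianProductWith (λ u w → w - u) xs xs))

    stretched : ∀ {u w} → u ∈ xs → w ∈ xs → 0ℚ < w - u → h + h < K * (w - u)
    stretched u∈ w∈ =
      All.lookup (proj₂ (∃-stretch (h + h) _)) (∈-cartesianProductWith⁺ _ u∈ w∈)

    gap : ∀ {u w} → u ∈ xs → w ∈ xs → u < w → K * u + h < K * w - h
    gap {u} {w} u∈ w∈ u<w = begin-strict
      K * u + h
        ≡⟨ solve 2 (λ Ku h → Ku :+ h := Ku :+ (h :+ h) :- h) refl (K * u) h ⟩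
      K * u + (h + h) - h
        <⟨ +-monoˡ-< (- h) (+-monoʳ-< (K * u) (stretched u∈ w∈ 0<w-u)) ⟩
      K * u + K * (w - u) - h
        ≡⟨ solve 4 (λ K u w h → K :* u :+ K :* (w :- u) :- h := K :* w :- h) refl K u w h ⟩
      K * w - h
        ∎
      where
      open ≤-Reasoning
      0<w-u : 0ℚ < w - u
      0<w-u = subst (_< w - u) (+-inverseʳ u) (+-monoˡ-< (- u) u<w)

module Lexicographic {Base : ℚ → Set} (scale : Scales.LexScale Base) where

  open import Data.Rational using (_≤_; _<_; _+_; _*_; -_; _-_)
  open import Data.Rational.Properties
  open import Relation.Binary.Definitions using (tri<; tri≈; tri>)
  open Boxes
  open Scales.LexScale scale hiding (small)
  open Scales.LexScale scale public using (small)

  Small : ℚ → Set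
  Small s = - h ≤ s × s ≤ h

  Based : Interval → Set
  Based I = Base (lo I) × Base (hi I)

  -h<h : - h < h
  -h<h = <-trans (neg-antimono-< 0<h) 0<h

  -- Kept opaque: otherwise checking statements about ind, which decides membership, unfolds
  -- the rational arithmetic inside φ and becomes very slow.
  opaque
    φ : ℚ → ℚ → ℚ
    φ u s = K * u + s

    φ-< : ∀ {u w s t} → Base u → Base w → u < w → Small s → Small t → φ u s < φ w t
    φ-< {u} {w} {s} {t} u∈ w∈ u<w (_ , s≤h) (-h≤t , _) = begin-strict
      K * u + s  ≤⟨ +-monoʳ-≤ (K * u) s≤h ⟩
      K * u + h  <⟨ gap u∈ w∈ u<w ⟩
      K * w - h  ≤⟨ +-monoʳ-≤ (K * w) -h≤t ⟩
      K * w + t  ∎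
      where open ≤-Reasoning

    LoOk-φ-window⁺ : ∀ f u {s t} → LoOk f s t → LoOk f (φ u s) (φ u t)
    LoOk-φ-window⁺ f u = LoOk-+ˡ⁺ f (K * u)

    LoOk-φ-window⁻ : ∀ f u {s t} → LoOk f (φ u s) (φ u t) → LoOk f s t
    LoOk-φ-window⁻ f u = LoOk-+ˡ⁻ f (K * u)

  φ-injective : ∀ {u w s t} → Base u → Base w → Small s → Small t →
                φ u s ≡ φ w t → u ≡ w × s ≡ t
  φ-injective {u} {w} u∈ w∈ s-small t-small eq with <-cmp u w
  ... | tri< u<w _ _ = contradiction eq (<⇒≢ (φ-< u∈ w∈ u<w s-small t-small))
  ... | tri≈ _ refl _ = refl , ≤-antisym (LoOk-φ-window⁻ true u (≤-reflexive eq))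
                                         (LoOk-φ-window⁻ true u (≤-reflexive (sym eq)))
  ... | tri> _ _ w<u = contradiction (sym eq) (<⇒≢ (φ-< w∈ u∈ w<u t-small s-small))

  LoOk-φ⁻ : ∀ f {u w s t} → Base u → Base w → Small s → Small t →
            (LoOk f s t → T f) → LoOk f (φ u s) (φ w t) → LoOk f u w
  LoOk-φ⁻ f {u} {w} u∈ w∈ s-small t-small tie p with <-cmp u w
  ... | tri< u<w _ _ = <⇒LoOk f u<w
  ... | tri≈ _ refl _ = T⇒LoOk-refl f (tie (LoOk-φ-window⁻ f u p))
  ... | tri> _ _ w<u = contradiction (LoOk⇒≤ f p) (<⇒≱ (φ-< w∈ u∈ w<u t-small s-small))

  LoOk-φ⁺ : ∀ f {u w s t} → Base u → Base w → Small s → Small t →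
            (T f → LoOk f s t) → LoOk f u w → LoOk f (φ u s) (φ w t)
  LoOk-φ⁺ f {u} {w} u∈ w∈ s-small t-small tie p with <-cmp u w
  ... | tri< u<w _ _ = <⇒LoOk f (φ-< u∈ w∈ u<w s-small t-small)
  ... | tri≈ _ refl _ = LoOk-φ-window⁺ f u (tie (LoOk-refl⇒T f p))
  ... | tri> _ _ w<u = contradiction (LoOk⇒≤ f p) (<⇒≱ w<u)

  slice : ℚ → Interval → Interval
  slice u (interval l r f g) = interval (φ u l) (φ u r) f g

  ∈-slice⁺ : ∀ {u s} I → s ∈I I → φ u s ∈I slice u I
  ∈-slice⁺ {u} (interval l r f g) (l≤s , s≤r) = LoOk-φ-window⁺ f u l≤s , LoOk-φ-window⁺ g u s≤r

  ∈-slice⁻ : ∀ {u u′ s} I → Based I → Base u → Base u′ → Base s →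
             φ u′ s ∈I slice u I → u′ ≡ u × s ∈I I
  ∈-slice⁻ {u} {u′} (interval l r f g) (l∈ , r∈) u∈ u′∈ s∈ (p , q) with <-cmp u′ u
  ... | tri< u′<u _ _ =
    contradiction (LoOk⇒≤ f p) (<⇒≱ (φ-< u′∈ u∈ u′<u (small s∈) (small l∈)))
  ... | tri≈ _ refl _ = refl , LoOk-φ-window⁻ f u p , LoOk-φ-window⁻ g u q
  ... | tri> _ _ u<u′ =
    contradiction (LoOk⇒≤ g q) (<⇒≱ (φ-< u∈ u′∈ u<u′ (small r∈) (small s∈)))

  slice-injective : ∀ {u u′} I J → Based I → Based J → Base u → Base u′ →
                    slice u I ≡ slice u′ J → u ≡ u′ × I ≡ J
  slice-injective (interval l r f g) (interval l′ r′ f′ g′) (l∈ , r∈) (l′∈ , r′∈) u∈ u′∈ eq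
    with φ-injective u∈ u′∈ (small l∈) (small l′∈) (cong lo eq)
       | φ-injective u∈ u′∈ (small r∈) (small r′∈) (cong hi eq)
       | cong loClosed eq | cong hiClosed eq
  ... | refl , refl | _ , refl | refl | refl = refl , refl

  slice-nonempty : ∀ u I → ∃ (_∈I I) → ∃ (_∈I slice u I)
  slice-nonempty u I (s , s∈I) = φ u s , ∈-slice⁺ I s∈I

  -- Offsets for thickening an interval to whole windows: a closed end takes in the whole window
  -- of its endpoint, an open end none of it.
  σ⁻ σ⁺ : Bool → ℚ
  σ⁻ true  = - h
  σ⁻ false = h
  σ⁺ true  = h
  σ⁺ false = - h

  σ⁻-small : ∀ f → Small (σ⁻ f)
  σ⁻-small true  = ≤-refl , <⇒≤ -h<h
  σ⁻-small false = <⇒≤ -h<h , ≤-refl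

  σ⁺-small : ∀ g → Small (σ⁺ g)
  σ⁺-small true  = <⇒≤ -h<h , ≤-refl
  σ⁺-small false = ≤-refl , <⇒≤ -h<h

  σ⁻-tie⁻ : ∀ f {s} → Small s → LoOk f (σ⁻ f) s → T f
  σ⁻-tie⁻ true  _          _   = _
  σ⁻-tie⁻ false (_ , s≤h) h<s = <⇒≱ h<s s≤h

  σ⁻-tie⁺ : ∀ f {s} → Small s → T f → LoOk f (σ⁻ f) s
  σ⁻-tie⁺ true (-h≤s , _) _ = -h≤s

  σ⁺-tie⁻ : ∀ g {s} → Small s → LoOk g s (σ⁺ g) → T g
  σ⁺-tie⁻ true  _           _    = _
  σ⁺-tie⁻ false (-h≤s , _) s<-h = <⇒≱ s<-h -h≤s

  σ⁺-tie⁺ : ∀ g {s} → Small s → T g → LoOk g s (σ⁺ g)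
  σ⁺-tie⁺ true (_ , s≤h) _ = s≤h

  thicken : Interval → Interval
  thicken (interval l r f g) = interval (φ l (σ⁻ f)) (φ r (σ⁺ g)) f g

  ∈-thicken⁻ : ∀ {u s} I → Based I → Base u → Base s → φ u s ∈I thicken I → u ∈I I
  ∈-thicken⁻ (interval l r f g) (l∈ , r∈) u∈ s∈ (p , q) =
    LoOk-φ⁻ f l∈ u∈ (σ⁻-small f) (small s∈) (σ⁻-tie⁻ f (small s∈)) p ,
    LoOk-φ⁻ g u∈ r∈ (small s∈) (σ⁺-small g) (σ⁺-tie⁻ g (small s∈)) q

  ∈-thicken⁺ : ∀ {u s} I → Based I → Base u → Base s → u ∈I I → φ u s ∈I thicken I
  ∈-thicken⁺ (interval l r f g) (l∈ , r∈) u∈ s∈ (p , q) =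
    LoOk-φ⁺ f l∈ u∈ (σ⁻-small f) (small s∈) (σ⁻-tie⁺ f (small s∈)) p ,
    LoOk-φ⁺ g u∈ r∈ (small s∈) (σ⁺-small g) (σ⁺-tie⁺ g (small s∈)) q

  thicken-injective : ∀ I J → Based I → Based J → thicken I ≡ thicken J → I ≡ J
  thicken-injective (interval l r f g) (interval l′ r′ f′ g′) (l∈ , r∈) (l′∈ , r′∈) eq
    with cong loClosed eq | cong hiClosed eq
  ... | refl | refl
    with φ-injective l∈ l′∈ (σ⁻-small f) (σ⁻-small f) (cong lo eq)
       | φ-injective r∈ r′∈ (σ⁺-small g) (σ⁺-small g) (cong hi eq)
  ... | refl , _ | refl , _ = refl

  thicken-nonempty : ∀ I → Based I → ∃ (_∈I I) → ∃ (_∈I thicken I)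
  thicken-nonempty (interval l r f g) (l∈ , r∈) (_ , x∈I) with ∈I⇒<⊎closed x∈I
  ... | inj₁ l<r = ∈-interval-< f g (φ-< l∈ r∈ l<r (σ⁻-small f) (σ⁺-small g))
  ... | inj₂ (refl , refl , refl) = ∈-interval-< true true (LoOk-φ-window⁺ false l -h<h)

  thicken≢slice[] : ∀ I {u t} → Based I → Base u → Base t → thicken I ≢ slice u [ t ]
  thicken≢slice[] (interval l r true true) (l∈ , r∈) u∈ t∈ eq =
    <⇒≢ -h<h (trans (proj₂ (φ-injective l∈ u∈ (σ⁻-small true) (small t∈) (cong lo eq)))
                    (sym (proj₂ (φ-injective r∈ u∈ (σ⁺-small true) (small t∈) (cong hi eq)))))
  thicken≢slice[] (interval l r false g) _ _ _ ()
  thicken≢slice[] (interval l r true false) _ _ _ ()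

module FiniteSums where

  open import Data.Fin using (punchIn; join; combine; _↑ˡ_; _↑ʳ_)
  open import Data.Fin.Properties using (punchInᵢ≢i; join-splitAt; remQuot-combine)
  open import Data.List using (map; tabulate; allFin)
  open import Data.List.Properties using (map-tabulate)
  open import Data.Nat using (ℕ; zero; suc; _+_; _*_)
  open import Data.Nat.Properties using (+-*-semiring; +-assoc; +-identityʳ)
  import Data.Nat.ListAction as List
  import Data.Sum as Sum
  open import Algebra.Properties.Semiring.Sum +-*-semiring public
    using (sum; sum-syntax; sum-cong-≗; ∑-distrib-+; *-distribˡ-sum)
  open import Algebra.Properties.Semiring.Sum +-*-semiring
    using (sum-remove; sum-replicate-zero)

  sum-tabulate : ∀ n (f : Fin n → ℕ) → List.sum (tabulate f) ≡ ∑[ i < n ] f i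
  sum-tabulate zero    f = refl
  sum-tabulate (suc n) f = cong (f zero +_) (sum-tabulate n (f ∘ suc))

  sum-map-allFin : ∀ n (f : Fin n → ℕ) → List.sum (map f (allFin n)) ≡ ∑[ i < n ] f i
  sum-map-allFin n f = trans (cong List.sum (map-tabulate id f)) (sum-tabulate n f)

  ∑-const : ∀ n c → ∑[ i < n ] c ≡ n * c
  ∑-const zero    c = refl
  ∑-const (suc n) c = cong (c +_) (∑-const n c)

  ∑-zero : ∀ {n} {f : Fin n → ℕ} → (∀ i → f i ≡ 0) → ∑[ i < n ] f i ≡ 0
  ∑-zero {n} f≡0 = trans (sum-cong-≗ f≡0) (sum-replicate-zero n)

  ∑-δ : ∀ {n} (f : Fin n → ℕ) i → (∀ j → j ≢ i → f j ≡ 0) → ∑[ j < n ] f j ≡ f i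
  ∑-δ {suc n} f i f≡0 = begin
    sum f                                ≡⟨ sum-remove f ⟩
    f i + ∑[ k < n ] f (punchIn i k)     ≡⟨ cong (f i +_) (∑-zero (λ k → f≡0 _ (punchInᵢ≢i i k))) ⟩
    f i + 0                              ≡⟨ +-identityʳ (f i) ⟩
    f i                                  ∎
    where open ≡-Reasoning

  ∑-splitAt : ∀ m n (f : Fin m ⊎ Fin n → ℕ) →
              ∑[ k < m + n ] f (splitAt m k) ≡ ∑[ i < m ] f (inj₁ i) + ∑[ j < n ] f (inj₂ j)
  ∑-splitAt zero    n f = refl
  ∑-splitAt (suc m) n f = trans (cong (f (inj₁ zero) +_) (∑-splitAt m n (f ∘ Sum.map₁ suc)))
                                (sym (+-assoc (f (inj₁ zero)) _ _))

  ∑-↑ : ∀ m n (g : Fin (m + n) → ℕ) →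
        ∑[ k < m + n ] g k ≡ ∑[ i < m ] g (i ↑ˡ n) + ∑[ j < n ] g (m ↑ʳ j)
  ∑-↑ m n g = trans (sum-cong-≗ (cong g ∘ sym ∘ join-splitAt m n)) (∑-splitAt m n (g ∘ join m n))

  ∑-combine : ∀ m n (g : Fin (m * n) → ℕ) →
              ∑[ k < m * n ] g k ≡ ∑[ i < m ] ∑[ j < n ] g (combine i j)
  ∑-combine zero    n g = refl
  ∑-combine (suc m) n g =
    trans (∑-↑ n (m * n) g) (cong (∑[ j < n ] g (j ↑ˡ m * n) +_) (∑-combine m n (g ∘ (n ↑ʳ_))))

  ∑-remQuot : ∀ m n (f : Fin m × Fin n → ℕ) →
              ∑[ k < m * n ] f (remQuot n k) ≡ ∑[ i < m ] ∑[ j < n ] f (i , j)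
  ∑-remQuot m n f = trans (∑-combine m n (f ∘ remQuot n))
                          (sum-cong-≗ λ i → sum-cong-≗ λ j → cong f (remQuot-combine i j))

module Incidences where

  open import Data.Fin.Properties using (_≟_; +↔⊎; *↔×)
  import Data.Sum as Sum
  open import Data.Sum.Properties using (inj₁-injective; inj₂-injective)
  open import Function.Bundles using (Injection)
  open import Function.Definitions using (Injective)
  open import Function.Properties.Inverse using (↔⇒↣)
  open import Relation.Nullary.Decidable using (decidable-stable)
  open FiniteSums using (sum; sum-syntax; sum-cong-≗; sum-map-allFin)
  open Boxes using (Nonempty; box-ext)

  incidences≡∑∑ : ∀ {j n₁ n₂} (P : Fin n₁ → Point j) (B : Fin n₂ → Box j) →
                  incidences P B ≡ ∑[ a < n₁ ] ∑[ b < n₂ ] ind (P a) (B b)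
  incidences≡∑∑ {n₁ = n₁} {n₂} P B =
    trans (sum-map-allFin n₁ _) (sum-cong-≗ {n₁} λ a → sum-map-allFin n₂ (ind (P a) ∘ B))

  ind-cong : ∀ {j j′} {p : Point j} {b} {p′ : Point j′} {b′} →
             (p ∈B b → p′ ∈B b′) → (p′ ∈B b′ → p ∈B b) → ind p b ≡ ind p′ b′
  ind-cong {p = p} {b} {p′} {b′} to from with p ∈B? b | p′ ∈B? b′
  ... | yes _  | yes _   = refl
  ... | no _   | no _    = refl
  ... | yes p∈ | no p′∉  = contradiction (to p∈) p′∉
  ... | no p∉  | yes p′∈ = contradiction (from p′∈) p∉

  ind-≡0 : ∀ {j} {p : Point j} {b} → ¬ p ∈B b → ind p b ≡ 0
  ind-≡0 {p = p} {b} p∉ with p ∈B? b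
  ... | yes p∈ = contradiction p∈ p∉
  ... | no _   = refl

  K22FreeRel : ∀ {A B : Set} → (A → B → Set) → Set
  K22FreeRel {A} {B} R = ∀ (a a′ : A) (b b′ : B) → a ≢ a′ → b ≢ b′ →
    ¬ ((R a b × R a b′) × (R a′ b × R a′ b′))

  K22FreeRel-pullback : ∀ {A B A′ B′ : Set} {R : A → B → Set} {R′ : A′ → B′ → Set}
                          {f : A′ → A} {g : B′ → B} →
                        Injective _≡_ _≡_ f → Injective _≡_ _≡_ g →
                        (∀ {x y} → R′ x y → R (f x) (g y)) → K22FreeRel R → K22FreeRel R′
  K22FreeRel-pullback f-inj g-inj R′⇒R R-free x x′ y y′ x≢x′ y≢y′ ((r₁ , r₂) , (r₃ , r₄)) =
    R-free _ _ _ _ (x≢x′ ∘ f-inj) (y≢y′ ∘ g-inj) ((R′⇒R r₁ , R′⇒R r₂) , (R′⇒R r₃ , R′⇒R r₄))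

  _□_ : ∀ {A B A′ B′ : Set} → (A → B → Set) → (A′ → B′ → Set) →
        A × A′ → (A × B′) ⊎ (A′ × B) → Set
  (R □ S) (a , a′) (inj₁ (α , b′)) = a ≡ α × S a′ b′
  (R □ S) (a , a′) (inj₂ (α′ , b)) = a′ ≡ α′ × R a b

  □-K22Free : ∀ {A B A′ B′ : Set} {R : A → B → Set} {S : A′ → B′ → Set} →
              K22FreeRel R → K22FreeRel S → K22FreeRel (R □ S)
  □-K22Free R-free S-free (a , a′) (_ , c′) (inj₁ (_ , b′)) (inj₁ (_ , d′)) x≢x′ y≢y′
    (((refl , s₁) , (refl , s₂)) , ((refl , s₃) , (refl , s₄))) =
    S-free a′ c′ b′ d′ (λ { refl → x≢x′ refl }) (λ { refl → y≢y′ refl }) ((s₁ , s₂) , (s₃ , s₄))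
  □-K22Free R-free S-free (a , a′) (c , _) (inj₂ (_ , b)) (inj₂ (_ , d)) x≢x′ y≢y′
    (((refl , r₁) , (refl , r₂)) , ((refl , r₃) , (refl , r₄))) =
    R-free a c b d (λ { refl → x≢x′ refl }) (λ { refl → y≢y′ refl }) ((r₁ , r₂) , (r₃ , r₄))
  □-K22Free _ _ _ _ (inj₁ _) (inj₂ _) x≢x′ _
    (((refl , _) , (refl , _)) , ((refl , _) , (refl , _))) = x≢x′ refl
  □-K22Free _ _ _ _ (inj₂ _) (inj₁ _) x≢x′ _
    (((refl , _) , (refl , _)) , ((refl , _) , (refl , _))) = x≢x′ refl

  DistinctPoints⇒injective : ∀ {j n} {P : Fin n → Point j} →
                             DistinctPoints P → Injective _≡_ _≗_ P
  DistinctPoints⇒injective distinct {a} {a′} P≗ =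
    decidable-stable (a ≟ a′) λ a≢a′ → distinct a a′ a≢a′ P≗

  injective⇒DistinctPoints : ∀ {j n} {P : Fin n → Point j} →
                             Injective _≡_ _≗_ P → DistinctPoints P
  injective⇒DistinctPoints injective a a′ a≢a′ = a≢a′ ∘ injective

  DistinctBoxes⇒injective : ∀ {j n} {B : Fin n → Box j} →
                            DistinctBoxes B → Injective _≡_ _≗_ B
  DistinctBoxes⇒injective {B = B} distinct {b} {b′} B≗ = decidable-stable (b ≟ b′) λ b≢b′ →
    distinct b b′ b≢b′ λ p → (λ p∈ i → subst (p i ∈I_) (B≗ i) (p∈ i))
                           , (λ p∈ i → subst (p i ∈I_) (sym (B≗ i)) (p∈ i))

  injective⇒DistinctBoxes : ∀ {j n} {B : Fin n → Box j} → (∀ b → Nonempty (B b)) →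
                            Injective _≡_ _≗_ B → DistinctBoxes B
  injective⇒DistinctBoxes nonempty injective b b′ b≢b′ same =
    b≢b′ (injective (box-ext (nonempty b) (proj₁ (same _)) (proj₂ (same _))))

  remQuot-injective : ∀ {m} n → Injective _≡_ _≡_ (remQuot {m} n)
  remQuot-injective {m} n = Injection.injective (↔⇒↣ (*↔× {m} {n}))

  splitAt-injective : ∀ m {n} → Injective _≡_ _≡_ (splitAt m {n})
  splitAt-injective m {n} = Injection.injective (↔⇒↣ (+↔⊎ {m} {n}))

  ⊎-map-injective : ∀ {A B C D : Set} {f : A → C} {g : B → D} →
                    Injective _≡_ _≡_ f → Injective _≡_ _≡_ g → Injective _≡_ _≡_ (Sum.map f g)
  ⊎-map-injective f-inj g-inj {inj₁ _} {inj₁ _} eq = cong inj₁ (f-inj (inj₁-injective eq))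
  ⊎-map-injective f-inj g-inj {inj₂ _} {inj₂ _} eq = cong inj₂ (g-inj (inj₂-injective eq))

module NonemptyBoxes where

  open import Data.Empty using (⊥-elim)
  open import Data.Fin.Properties using (_≟_)
  open import Data.List using (_++_; tabulate)
  open import Data.List.Membership.Propositional.Properties using (∈-++⁺ˡ; ∈-++⁺ʳ; ∈-tabulate⁺)
  open import Data.List.Relation.Unary.All as All using (All)
  open import Data.Rational using (_<_)
  open import Data.Rational.Properties using (<⇒≢; ≤-refl)
  open import Function.Definitions using (Injective)
  open import Relation.Nullary.Decidable using (decidable-stable)
  open Boxes
  open Incidences
  open FiniteSums using (sum; sum-syntax; sum-cong-≗)
  open Scales using (∃-upperBound)

  ∉-empty : ∀ {j} {B : Box j} {p} → ¬ Nonempty B → ¬ p ∈B B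
  ∉-empty {p = p} empty p∈B = empty λ i → p i , p∈B i

  module Replace {j n₁ n₂ m} (C : Config (suc j) n₁ n₂ m) where
    open Config C

    far-bound : ∃ λ far →
                All (_< far) (tabulate (λ a → pts a zero) ++ tabulate (λ b → lo (boxes b zero)))
    far-bound = ∃-upperBound _

    far : ℚ
    far = proj₁ far-bound

    pt<far : ∀ a → pts a zero < far
    pt<far a = All.lookup (proj₂ far-bound) (∈-++⁺ˡ (∈-tabulate⁺ a))

    lo<far : ∀ b → lo (boxes b zero) < far
    lo<far b =
      All.lookup (proj₂ far-bound) (∈-++⁺ʳ (tabulate (λ a → pts a zero)) (∈-tabulate⁺ b))

    boxes′ : Fin n₂ → Box (suc j)
    boxes′ b with nonempty? (boxes b)
    ... | yes _ = boxes b
    ... | no _  = λ _ → [ far ]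

    ∈-boxes′⁻ : ∀ a b → pts a ∈B boxes′ b → pts a ∈B boxes b
    ∈-boxes′⁻ a b p∈ with nonempty? (boxes b)
    ... | yes _ = p∈
    ... | no _  = contradiction (∈-[]⁻ (p∈ zero)) (<⇒≢ (pt<far a))

    ∈-boxes′⁺ : ∀ a b → pts a ∈B boxes b → pts a ∈B boxes′ b
    ∈-boxes′⁺ a b p∈ with nonempty? (boxes b)
    ... | yes _     = p∈
    ... | no empty = contradiction p∈ (∉-empty empty)

    boxes′-nonempty : ∀ b → Nonempty (boxes′ b)
    boxes′-nonempty b with nonempty? (boxes b)
    ... | yes nonempty = nonempty
    ... | no _         = λ _ → far , ≤-refl , ≤-refl

    boxes′-injective : Injective _≡_ _≗_ boxes′
    boxes′-injective {b} {b′} eq with nonempty? (boxes b) | nonempty? (boxes b′)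
    ... | yes _ | yes _ = DistinctBoxes⇒injective boxDist eq
    ... | no empty | no empty′ = decidable-stable (b ≟ b′) λ b≢b′ →
      boxDist b b′ b≢b′ λ _ → ⊥-elim ∘ ∉-empty empty , ⊥-elim ∘ ∉-empty empty′
    ... | yes _ | no _ = contradiction (cong lo (eq zero)) (<⇒≢ (lo<far b))
    ... | no _ | yes _ = contradiction (sym (cong lo (eq zero))) (<⇒≢ (lo<far b′))

    incidences-boxes′ : incidences pts boxes′ ≡ m
    incidences-boxes′ = begin
      incidences pts boxes′
        ≡⟨ incidences≡∑∑ pts boxes′ ⟩
      ∑[ a < n₁ ] ∑[ b < n₂ ] ind (pts a) (boxes′ b)
        ≡⟨ sum-cong-≗ (λ a → sum-cong-≗ λ b → ind-cong (∈-boxes′⁻ a b) (∈-boxes′⁺ a b)) ⟩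
      ∑[ a < n₁ ] ∑[ b < n₂ ] ind (pts a) (boxes b)
        ≡⟨ incidences≡∑∑ pts boxes ⟨
      incidences pts boxes
        ≡⟨ incCount ⟩
      m ∎
      where open ≡-Reasoning

    config : Config (suc j) n₁ n₂ m
    config = record
      { pts      = pts
      ; boxes    = boxes′
      ; ptsDist  = ptsDist
      ; boxDist  = injective⇒DistinctBoxes boxes′-nonempty boxes′-injective
      ; incCount = incidences-boxes′
      ; k22free  = K22FreeRel-pullback id id (λ {a} {b} → ∈-boxes′⁻ a b) k22free
      }

  withNonemptyBoxes : ∀ {j n₁ n₂ m} → Config j n₁ n₂ m →
                      Σ (Config j n₁ n₂ m) λ C → ∀ b → Nonempty (Config.boxes C b)
  withNonemptyBoxes {zero}  C = C , λ _ ()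
  withNonemptyBoxes {suc j} C = Replace.config C , Replace.boxes′-nonempty C

module Values where

  open import Data.List using (List; _++_; tabulate; concat)
  open import Data.List.Membership.Propositional using (_∈_)
  open import Data.List.Membership.Propositional.Properties
    using (∈-++⁺ˡ; ∈-++⁺ʳ; ∈-tabulate⁺; ∈-concat⁺′)

  entries : ∀ {k l} → (Fin k → Fin l → ℚ) → List ℚ
  entries f = concat (tabulate (tabulate ∘ f))

  ∈-entries : ∀ {k l} (f : Fin k → Fin l → ℚ) a i → f a i ∈ entries f
  ∈-entries f a i = ∈-concat⁺′ (∈-tabulate⁺ i) (∈-tabulate⁺ a)

  values : ∀ {j k l r} → Config j k l r → List ℚ
  values C = entries pts ++ entries (lo ∘₂ boxes) ++ entries (hi ∘₂ boxes)
    where open Config C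

  pts∈values : ∀ {j k l r} (C : Config j k l r) a i → Config.pts C a i ∈ values C
  pts∈values C a i = ∈-++⁺ˡ (∈-entries (Config.pts C) a i)

  lo∈values : ∀ {j k l r} (C : Config j k l r) b i → lo (Config.boxes C b i) ∈ values C
  lo∈values C b i = ∈-++⁺ʳ (entries pts) (∈-++⁺ˡ (∈-entries (lo ∘₂ boxes) b i))
    where open Config C

  hi∈values : ∀ {j k l r} (C : Config j k l r) b i → hi (Config.boxes C b i) ∈ values C
  hi∈values C b i =
    ∈-++⁺ʳ (entries pts) (∈-++⁺ʳ (entries (lo ∘₂ boxes)) (∈-entries (hi ∘₂ boxes) b i))
    where open Config C

module Construction {e n₁ n₂ n₁' n₂' m m'}
  (CP : Config e n₁ n₂ m) (CQ : Config (suc e) n₁' n₂' m')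
  (P-nonempty : ∀ b → Boxes.Nonempty (Config.boxes CP b))
  (Q-nonempty : ∀ b → Boxes.Nonempty (Config.boxes CQ b)) where

  import Data.Nat as ℕ
  open import Data.Nat.Properties using (*-comm)
  open import Data.Fin using (toℕ)
  open import Data.Fin.Properties using (toℕ-injective)
  import Data.Integer as ℤ
  import Data.Integer.Properties as ℤ
  open import Data.List using (List; _++_; tabulate)
  open import Data.List.Membership.Propositional using (_∈_)
  open import Data.List.Membership.Propositional.Properties using (∈-++⁺ˡ; ∈-++⁺ʳ; ∈-tabulate⁺)
  open import Data.Rational using (↥_)
  open import Data.Rational.Literals using (fromℤ)
  open import Data.Rational.Properties using (≤-refl)
  import Data.Sum as Sum
  open import Function.Definitions using (Injective)
  open Boxes
  open Incidences
  open FiniteSums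
  open Values

  module P = Config CP
  module Q = Config CQ

  tag : Fin n₁' → ℚ
  tag a′ = fromℤ (ℤ.+ toℕ a′)

  tag-injective : Injective _≡_ _≡_ tag
  tag-injective = toℕ-injective ∘ ℤ.+-injective ∘ cong ↥_

  coordinates : List ℚ
  coordinates = values CP ++ values CQ ++ tabulate tag

  open Lexicographic (Scales.lexScale coordinates)

  P-base : ∀ a k → P.pts a k ∈ coordinates
  P-base a k = ∈-++⁺ˡ (pts∈values CP a k)

  P-based : ∀ b k → Based (P.boxes b k)
  P-based b k = ∈-++⁺ˡ (lo∈values CP b k) , ∈-++⁺ˡ (hi∈values CP b k)

  Q-base : ∀ a′ i → Q.pts a′ i ∈ coordinates
  Q-base a′ i = ∈-++⁺ʳ (values CP) (∈-++⁺ˡ (pts∈values CQ a′ i))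

  Q-based : ∀ b′ i → Based (Q.boxes b′ i)
  Q-based b′ i = ∈-++⁺ʳ (values CP) (∈-++⁺ˡ (lo∈values CQ b′ i))
               , ∈-++⁺ʳ (values CP) (∈-++⁺ˡ (hi∈values CQ b′ i))

  tag-base : ∀ a′ → tag a′ ∈ coordinates
  tag-base a′ = ∈-++⁺ʳ (values CP) (∈-++⁺ʳ (values CQ) (∈-tabulate⁺ a′))

  point : Fin n₁ × Fin n₁' → Point (suc e)
  point (a , a′) zero    = φ (Q.pts a′ zero) (tag a′)
  point (a , a′) (suc k) = φ (P.pts a k) (Q.pts a′ (suc k))

  box : (Fin n₁ × Fin n₂') ⊎ (Fin n₁' × Fin n₂) → Box (suc e)
  box (inj₁ (a , b′)) zero    = thicken (Q.boxes b′ zero)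
  box (inj₁ (a , b′)) (suc k) = slice (P.pts a k) (Q.boxes b′ (suc k))
  box (inj₂ (a′ , b)) zero    = slice (Q.pts a′ zero) [ tag a′ ]
  box (inj₂ (a′ , b)) (suc k) = thicken (P.boxes b k)

  P-injective : Injective _≡_ _≗_ P.pts
  P-injective = DistinctPoints⇒injective P.ptsDist

  P-box-injective : Injective _≡_ _≗_ P.boxes
  P-box-injective = DistinctBoxes⇒injective P.boxDist

  Q-box-injective : Injective _≡_ _≗_ Q.boxes
  Q-box-injective = DistinctBoxes⇒injective Q.boxDist

  ∈-box₁⁻ : ∀ {a a′ α b′} → point (a , a′) ∈B box (inj₁ (α , b′)) →
            a ≡ α × Q.pts a′ ∈B Q.boxes b′
  ∈-box₁⁻ {a} {a′} {α} {b′} x∈ = P-injective (proj₁ ∘ sliced) , λ where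
      zero    → ∈-thicken⁻ (Q.boxes b′ zero) (Q-based b′ zero) (Q-base a′ zero) (tag-base a′)
                           (x∈ zero)
      (suc k) → proj₂ (sliced k)
    where
    sliced : ∀ k → P.pts a k ≡ P.pts α k × Q.pts a′ (suc k) ∈I Q.boxes b′ (suc k)
    sliced k = ∈-slice⁻ (Q.boxes b′ (suc k)) (Q-based b′ (suc k)) (P-base α k) (P-base a k)
                        (Q-base a′ (suc k)) (x∈ (suc k))

  ∈-box₁⁺ : ∀ {a a′ b′} → Q.pts a′ ∈B Q.boxes b′ → point (a , a′) ∈B box (inj₁ (a , b′))
  ∈-box₁⁺ {a} {a′} {b′} q∈ zero    =
    ∈-thicken⁺ (Q.boxes b′ zero) (Q-based b′ zero) (Q-base a′ zero) (tag-base a′) (q∈ zero)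
  ∈-box₁⁺ {a} {a′} {b′} q∈ (suc k) = ∈-slice⁺ (Q.boxes b′ (suc k)) (q∈ (suc k))

  ∈-box₂⁻ : ∀ {a a′ α′ b} → point (a , a′) ∈B box (inj₂ (α′ , b)) →
            a′ ≡ α′ × P.pts a ∈B P.boxes b
  ∈-box₂⁻ {a} {a′} {α′} {b} x∈ = tag-injective (∈-[]⁻ (proj₂ sliced)) , λ k →
    ∈-thicken⁻ (P.boxes b k) (P-based b k) (P-base a k) (Q-base a′ (suc k)) (x∈ (suc k))
    where
    sliced : Q.pts a′ zero ≡ Q.pts α′ zero × tag a′ ∈I [ tag α′ ]
    sliced = ∈-slice⁻ [ tag α′ ] (tag-base α′ , tag-base α′) (Q-base α′ zero) (Q-base a′ zero)
                      (tag-base a′) (x∈ zero)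

  ∈-box₂⁺ : ∀ {a a′ b} → P.pts a ∈B P.boxes b → point (a , a′) ∈B box (inj₂ (a′ , b))
  ∈-box₂⁺ {a} {a′} {b} p∈ zero    = ∈-slice⁺ [ tag a′ ] (≤-refl , ≤-refl)
  ∈-box₂⁺ {a} {a′} {b} p∈ (suc k) =
    ∈-thicken⁺ (P.boxes b k) (P-based b k) (P-base a k) (Q-base a′ (suc k)) (p∈ k)

  P-incidence : Fin n₁ → Fin n₂ → Set
  P-incidence a b = P.pts a ∈B P.boxes b

  Q-incidence : Fin n₁' → Fin n₂' → Set
  Q-incidence a′ b′ = Q.pts a′ ∈B Q.boxes b′

  ∈-box⁻ : ∀ {x y} → point x ∈B box y → (P-incidence □ Q-incidence) x y
  ∈-box⁻ {_ , _} {inj₁ (_ , _)} = ∈-box₁⁻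
  ∈-box⁻ {_ , _} {inj₂ (_ , _)} = ∈-box₂⁻

  point-injective : Injective _≡_ _≗_ point
  point-injective {a , a′} {α , α′} eq = cong₂ _,_
    (P-injective λ k → proj₁ (φ-injective (P-base a k) (P-base α k)
      (small (Q-base a′ (suc k))) (small (Q-base α′ (suc k))) (eq (suc k))))
    (tag-injective (proj₂ (φ-injective (Q-base a′ zero) (Q-base α′ zero)
      (small (tag-base a′)) (small (tag-base α′)) (eq zero))))

  box-injective : Injective _≡_ _≗_ box
  box-injective {inj₁ (a , b′)} {inj₁ (α , β′)} eq =
    cong inj₁ (cong₂ _,_ (P-injective (proj₁ ∘ sliced)) (Q-box-injective λ where
      zero    → thicken-injective _ _ (Q-based b′ zero) (Q-based β′ zero) (eq zero)
      (suc k) → proj₂ (sliced k)))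
    where
    sliced : ∀ k → P.pts a k ≡ P.pts α k × Q.boxes b′ (suc k) ≡ Q.boxes β′ (suc k)
    sliced k = slice-injective _ _ (Q-based b′ (suc k)) (Q-based β′ (suc k))
                               (P-base a k) (P-base α k) (eq (suc k))
  box-injective {inj₂ (a′ , b)} {inj₂ (α′ , β)} eq =
    cong inj₂ (cong₂ _,_ (tag-injective (cong lo (proj₂ sliced))) (P-box-injective λ k →
      thicken-injective _ _ (P-based b k) (P-based β k) (eq (suc k))))
    where
    sliced : Q.pts a′ zero ≡ Q.pts α′ zero × [ tag a′ ] ≡ [ tag α′ ]
    sliced = slice-injective _ _ (tag-base a′ , tag-base a′) (tag-base α′ , tag-base α′)
                             (Q-base a′ zero) (Q-base α′ zero) (eq zero)
  box-injective {inj₁ (_ , b′)} {inj₂ (α′ , _)} eq = contradiction (eq zero)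
    (thicken≢slice[] (Q.boxes b′ zero) (Q-based b′ zero) (Q-base α′ zero) (tag-base α′))
  box-injective {inj₂ (a′ , _)} {inj₁ (_ , β′)} eq = contradiction (sym (eq zero))
    (thicken≢slice[] (Q.boxes β′ zero) (Q-based β′ zero) (Q-base a′ zero) (tag-base a′))

  box-nonempty : ∀ y → Nonempty (box y)
  box-nonempty (inj₁ (a , b′)) zero    =
    thicken-nonempty (Q.boxes b′ zero) (Q-based b′ zero) (Q-nonempty b′ zero)
  box-nonempty (inj₁ (a , b′)) (suc k) =
    slice-nonempty (P.pts a k) (Q.boxes b′ (suc k)) (Q-nonempty b′ (suc k))
  box-nonempty (inj₂ (a′ , b)) zero    =
    slice-nonempty (Q.pts a′ zero) [ tag a′ ] (tag a′ , ≤-refl , ≤-refl)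
  box-nonempty (inj₂ (a′ , b)) (suc k) =
    thicken-nonempty (P.boxes b k) (P-based b k) (P-nonempty b k)

  N : ℕ
  N = n₁ ℕ.* n₂' ℕ.+ n₁' ℕ.* n₂

  pointIndex : Fin (n₁ ℕ.* n₁') → Fin n₁ × Fin n₁'
  pointIndex = remQuot n₁'

  boxIndex : Fin N → (Fin n₁ × Fin n₂') ⊎ (Fin n₁' × Fin n₂)
  boxIndex = Sum.map (remQuot n₂') (remQuot n₂) ∘ splitAt (n₁ ℕ.* n₂')

  boxIndex-injective : Injective _≡_ _≡_ boxIndex
  boxIndex-injective =
    splitAt-injective (n₁ ℕ.* n₂') ∘ ⊎-map-injective (remQuot-injective n₂') (remQuot-injective n₂)

  P-degree : Fin n₁ → ℕ
  P-degree a = ∑[ b < n₂ ] ind (P.pts a) (P.boxes b)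

  Q-degree : Fin n₁' → ℕ
  Q-degree a′ = ∑[ b′ < n₂' ] ind (Q.pts a′) (Q.boxes b′)

  off-diagonal₁ : ∀ {a a′ α} → α ≢ a → ∑[ b′ < n₂' ] ind (point (a , a′)) (box (inj₁ (α , b′))) ≡ 0
  off-diagonal₁ α≢a = ∑-zero {n₂'} λ b′ → ind-≡0 (α≢a ∘ sym ∘ proj₁ ∘ ∈-box₁⁻)

  off-diagonal₂ : ∀ {a a′ α′} → α′ ≢ a′ → ∑[ b < n₂ ] ind (point (a , a′)) (box (inj₂ (α′ , b))) ≡ 0
  off-diagonal₂ α′≢a′ = ∑-zero {n₂} λ b → ind-≡0 (α′≢a′ ∘ sym ∘ proj₁ ∘ ∈-box₂⁻)

  diagonal₁ : ∀ a a′ → ∑[ b′ < n₂' ] ind (point (a , a′)) (box (inj₁ (a , b′))) ≡ Q-degree a′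
  diagonal₁ a a′ = sum-cong-≗ {n₂'} λ b′ → ind-cong (proj₂ ∘ ∈-box₁⁻) ∈-box₁⁺

  diagonal₂ : ∀ a a′ → ∑[ b < n₂ ] ind (point (a , a′)) (box (inj₂ (a′ , b))) ≡ P-degree a
  diagonal₂ a a′ = sum-cong-≗ {n₂} λ b → ind-cong (proj₂ ∘ ∈-box₂⁻) ∈-box₂⁺

  degree : ∀ a a′ → ∑[ y < N ] ind (point (a , a′)) (box (boxIndex y)) ≡ Q-degree a′ ℕ.+ P-degree a
  degree a a′ = begin
    ∑[ y < N ] hits (boxIndex y)
      ≡⟨ ∑-splitAt (n₁ ℕ.* n₂') (n₁' ℕ.* n₂) (hits ∘ Sum.map (remQuot n₂') (remQuot n₂)) ⟩
    ∑[ z < n₁ ℕ.* n₂' ] hits (inj₁ (remQuot n₂' z)) ℕ.+ ∑[ z < n₁' ℕ.* n₂ ] hits (inj₂ (remQuot n₂ z))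
      ≡⟨ cong₂ ℕ._+_ (∑-remQuot n₁ n₂' (hits ∘ inj₁)) (∑-remQuot n₁' n₂ (hits ∘ inj₂)) ⟩
    ∑[ α < n₁ ] ∑[ b′ < n₂' ] hits (inj₁ (α , b′)) ℕ.+ ∑[ α′ < n₁' ] ∑[ b < n₂ ] hits (inj₂ (α′ , b))
      ≡⟨ cong₂ ℕ._+_ (∑-δ (λ α → ∑[ b′ < n₂' ] hits (inj₁ (α , b′))) a λ _ → off-diagonal₁)
                     (∑-δ (λ α′ → ∑[ b < n₂ ] hits (inj₂ (α′ , b))) a′ λ _ → off-diagonal₂) ⟩
    ∑[ b′ < n₂' ] hits (inj₁ (a , b′)) ℕ.+ ∑[ b < n₂ ] hits (inj₂ (a′ , b))
      ≡⟨ cong₂ ℕ._+_ (diagonal₁ a a′) (diagonal₂ a a′) ⟩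
    Q-degree a′ ℕ.+ P-degree a ∎
    where
    open ≡-Reasoning
    hits : (Fin n₁ × Fin n₂') ⊎ (Fin n₁' × Fin n₂) → ℕ
    hits y = ind (point (a , a′)) (box y)

  count : incidences (point ∘ pointIndex) (box ∘ boxIndex) ≡ n₁ ℕ.* m' ℕ.+ m ℕ.* n₁'
  count = begin
    incidences (point ∘ pointIndex) (box ∘ boxIndex)
      ≡⟨ incidences≡∑∑ (point ∘ pointIndex) (box ∘ boxIndex) ⟩
    ∑[ x < n₁ ℕ.* n₁' ] ∑[ y < N ] ind (point (pointIndex x)) (box (boxIndex y))
      ≡⟨ ∑-remQuot n₁ n₁' (λ x → ∑[ y < N ] ind (point x) (box (boxIndex y))) ⟩
    ∑[ a < n₁ ] ∑[ a′ < n₁' ] ∑[ y < N ] ind (point (a , a′)) (box (boxIndex y))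
      ≡⟨ sum-cong-≗ {n₁} (λ a → sum-cong-≗ {n₁'} (degree a)) ⟩
    ∑[ a < n₁ ] ∑[ a′ < n₁' ] (Q-degree a′ ℕ.+ P-degree a)
      ≡⟨ sum-cong-≗ {n₁} row ⟩
    ∑[ a < n₁ ] (m' ℕ.+ n₁' ℕ.* P-degree a)
      ≡⟨ ∑-distrib-+ (const m') (λ a → n₁' ℕ.* P-degree a) ⟩
    ∑[ a < n₁ ] m' ℕ.+ ∑[ a < n₁ ] (n₁' ℕ.* P-degree a)
      ≡⟨ cong₂ ℕ._+_ (∑-const n₁ m') (trans (sym (*-distribˡ-sum n₁' P-degree))
                                            (cong (n₁' ℕ.*_) P-total)) ⟩
    n₁ ℕ.* m' ℕ.+ n₁' ℕ.* m
      ≡⟨ cong (n₁ ℕ.* m' ℕ.+_) (*-comm n₁' m) ⟩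
    n₁ ℕ.* m' ℕ.+ m ℕ.* n₁' ∎
    where
    open ≡-Reasoning
    P-total : ∑[ a < n₁ ] P-degree a ≡ m
    P-total = trans (sym (incidences≡∑∑ P.pts P.boxes)) P.incCount
    Q-total : ∑[ a′ < n₁' ] Q-degree a′ ≡ m'
    Q-total = trans (sym (incidences≡∑∑ Q.pts Q.boxes)) Q.incCount
    row : ∀ a → ∑[ a′ < n₁' ] (Q-degree a′ ℕ.+ P-degree a) ≡ m' ℕ.+ n₁' ℕ.* P-degree a
    row a = trans (∑-distrib-+ Q-degree (const (P-degree a)))
                  (cong₂ ℕ._+_ Q-total (∑-const n₁' (P-degree a)))

  config : Config (suc e) (n₁ ℕ.* n₁') N (n₁ ℕ.* m' ℕ.+ m ℕ.* n₁')
  config = record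
    { pts      = point ∘ pointIndex
    ; boxes    = box ∘ boxIndex
    ; ptsDist  = injective⇒DistinctPoints (remQuot-injective n₁' ∘ point-injective)
    ; boxDist  = injective⇒DistinctBoxes (box-nonempty ∘ boxIndex)
                                         (boxIndex-injective ∘ box-injective)
    ; incCount = count
    ; k22free  = K22FreeRel-pullback (remQuot-injective n₁') boxIndex-injective ∈-box⁻
                                     (□-K22Free P.k22free Q.k22free)
    }


open NonemptyBoxes using (withNonemptyBoxes)
open import Data.Nat using (_+_; _*_; _∸_; _≤_)

lemma3p3 : (d n₁ n₂ n₁' n₂' m m' : ℕ) →
    1 ≤ d → 1 ≤ n₁ → 1 ≤ n₂ → 1 ≤ n₁' → 1 ≤ n₂' → 1 ≤ m → 1 ≤ m' →
    Config (d ∸ 1) n₁ n₂ m →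
    Config d n₁' n₂' m' →
    Config d (n₁ * n₁') (n₁ * n₂' + n₁' * n₂) (n₁ * m' + m * n₁')
lemma3p3 zero    _ _ _ _ _ _ () _ _ _ _ _ _ _ _
lemma3p3 (suc e) _ _ _ _ _ _ _  _ _ _ _ _ _ CP CQ
  with withNonemptyBoxes CP | withNonemptyBoxes CQ
... | CP′ , P-nonempty | CQ′ , Q-nonempty = Construction.config CP′ CQ′ P-nonempty Q-nonempty
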